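{- For every $\varphi\in\mathcal{L}_{AIL}$, the closure $cl(\varphi)$ is finite.
   Context: $\mathcal{P}$ is a countable set of atomic propositions, $\mathcal{G}$ a finite set of agents; $\mathcal{L}_{AIL}$ is generated by $\varphi::= p\mid\neg\varphi\mid\varphi\wedge\varphi\mid A_i\varphi\mid I_i\varphi\mid E_i\varphi\mid[\approx]_i\varphi\mid[\circ^+]_i\varphi$ ($p\in\mathcal{P}$, $i\in\mathcal{G}$). For $\varphi\in\mathcal{L}_{AIL}$, $cl(\varphi)$ is the smallest set of formulae such that: (1) $\varphi\in cl(\varphi)$; (2) if $\psi\in cl(\varphi)$ then every subformula of $\psi$ is in $cl(\varphi)$; (3) if $\psi\in cl(\varphi)$ and $\psi$ is not a negation, then $\neg\psi\in cl(\varphi)$; (4) if $A_i\psi\in cl(\varphi)$ then $A_i\chi\in cl(\varphi)$ for every subformula $\chi$ of $\psi$; (5) if $A_i\psi\in cl(\varphi)$ then $I_iA_i\psi$, $I_i\neg A_i\psi$ and $[\approx]_ip$ are in $cl(\varphi)$ for every atomic $p$ that is a subformula of $\psi$; (6) if $I_i\psi\in cl(\varphi)$ and $\psi$ is of neither form $I_i\chi$ nor $\neg I_i\chi$, then $I_iI_i\psi, I_i\neg I_i\psi\in cl(\varphi)$; (7) if $[\approx]_i\psi\in cl(\varphi)$ and $\psi$ is of neither form $[\approx]_i\chi$ nor $\neg[\approx]_i\chi$, then $[\approx]_i[\approx]_i\psi,[\approx]_i\neg[\approx]_i\psi\in cl(\varphi)$; (8) if $[\circ^+]_i\psi\in cl(\varphi)$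 then $[\approx]_iI_i[\circ^+]_i\psi\in cl(\varphi)$; (9) if $E_i\psi\in cl(\varphi)$ then $A_i\psi,[\circ^+]_i\psi\in cl(\varphi)$. -}

module Defs where

open import Data.Nat using (ℕ)
open import Data.Fin using (Fin)
open import Data.List using (List)
open import Data.List.Membership.Propositional using (_∈_)
open import Data.Product using (Σ; ∃)
open import Function.Bundles using (_⇔_)
open import Relation.Nullary using (¬_)
open import Relation.Binary.PropositionalEquality using (_≡_)

-- Formulas of L_AIL over agents Fin g (a finite set G) and atoms ℕ (countable P).
data Form (g : ℕ) : Set where
  atom  : ℕ → Form g
  neg   : Form g → Form g
  conj  : Form g → Form g → Form g
  A     : Fin g → Form g → Form g
  I     : Fin g → Form g → Form g
  E     : Fin g → Form g → Form g
  Sim   : Fin g → Form g → Form g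
  Circ  : Fin g → Form g → Form g

data Sub {g : ℕ} : Form g → Form g → Set where
  sub-refl  : ∀ {ψ} → Sub ψ ψ
  sub-neg   : ∀ {χ ψ} → Sub χ ψ → Sub χ (neg ψ)
  sub-conjˡ : ∀ {χ ψ θ} → Sub χ ψ → Sub χ (conj ψ θ)
  sub-conjʳ : ∀ {χ ψ θ} → Sub χ θ → Sub χ (conj ψ θ)
  sub-A     : ∀ {χ ψ i} → Sub χ ψ → Sub χ (A i ψ)
  sub-I     : ∀ {χ ψ i} → Sub χ ψ → Sub χ (I i ψ)
  sub-E     : ∀ {χ ψ i} → Sub χ ψ → Sub χ (E i ψ)
  sub-Sim   : ∀ {χ ψ i} → Sub χ ψ → Sub χ (Sim i ψ)
  sub-Circ  : ∀ {χ ψ i} → Sub χ ψ → Sub χ (Circ i ψ)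

IsNeg : ∀ {g} → Form g → Set
IsNeg ψ = ∃ λ χ → ψ ≡ neg χ

IsIForm : ∀ {g} → Fin g → Form g → Set
IsIForm i ψ = (∃ λ χ → ψ ≡ I i χ) Data.Sum.⊎ (∃ λ χ → ψ ≡ neg (I i χ))
  where import Data.Sum

IsSimForm : ∀ {g} → Fin g → Form g → Set
IsSimForm i ψ = (∃ λ χ → ψ ≡ Sim i χ) Data.Sum.⊎ (∃ λ χ → ψ ≡ neg (Sim i χ))
  where import Data.Sum

data Cl {g : ℕ} (φ : Form g) : Form g → Set where
  cl-1   : Cl φ φ
  cl-2   : ∀ {ψ χ} → Cl φ ψ → Sub χ ψ → Cl φ χ
  cl-3   : ∀ {ψ} → Cl φ ψ → ¬ IsNeg ψ → Cl φ (neg ψ)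
  cl-4   : ∀ {i ψ χ} → Cl φ (A i ψ) → Sub χ ψ → Cl φ (A i χ)
  cl-5a  : ∀ {i ψ} → Cl φ (A i ψ) → Cl φ (I i (A i ψ))
  cl-5b  : ∀ {i ψ} → Cl φ (A i ψ) → Cl φ (I i (neg (A i ψ)))
  cl-5c  : ∀ {i ψ p} → Cl φ (A i ψ) → Sub (atom p) ψ → Cl φ (Sim i (atom p))
  cl-6a  : ∀ {i ψ} → Cl φ (I i ψ) → ¬ IsIForm i ψ → Cl φ (I i (I i ψ))
  cl-6b  : ∀ {i ψ} → Cl φ (I i ψ) → ¬ IsIForm i ψ → Cl φ (I i (neg (I i ψ)))
  cl-7a  : ∀ {i ψ} → Cl φ (Sim i ψ) → ¬ IsSimForm i ψ → Cl φ (Sim i (Sim i ψ))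
  cl-7b  : ∀ {i ψ} → Cl φ (Sim i ψ) → ¬ IsSimForm i ψ → Cl φ (Sim i (neg (Sim i ψ)))
  cl-8   : ∀ {i ψ} → Cl φ (Circ i ψ) → Cl φ (Sim i (I i (Circ i ψ)))
  cl-9a  : ∀ {i ψ} → Cl φ (E i ψ) → Cl φ (A i ψ)
  cl-9b  : ∀ {i ψ} → Cl φ (E i ψ) → Cl φ (Circ i ψ)

IsFinite : {X : Set} → (X → Set) → Set
IsFinite {X} P = Σ (List X) λ L → ∀ x → P x ⇔ x ∈ L

{-# OPTIONS --safe #-}
module Submission where

-- cl(φ) is built in four finite stages. Stage 0 consists of the subformulas of φ and their
-- successors under rules 4 and 9 (a composite of such steps is again one). Each later stage
-- applies one group of rules once, first (5, 8), then (6, 7), then 3, and adds all subformulas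
-- of the results. One pass per group suffices because, besides subformulas of its premises, a
-- group only adds formulas that neither it nor an earlier group accepts as premises: rules 5 and
-- 8 add ¬-, I_i- and [≈]_i-formulas while rules 4, 5, 8, 9 act on A_i-, E_i- and
-- [∘⁺]_i-formulas; rules 6 and 7 add negations and formulas I_i ψ, [≈]_i ψ whose ψ violates
-- their side condition; rule 3 adds negations. Every stage is finite since a formula has
-- finitely many subformulas and every premise has finitely many successors.

open import Defs
open import Data.Nat using (ℕ)
open import Data.Fin using (Fin)
open import Data.Fin.Properties using (_≟_)
open import Data.List using ([]; _∷_; _++_; concatMap)
open import Data.List.Membership.Propositional.Properties using (++-∈⇔; >>=-∈↔)
open import Data.List.Relation.Unary.Any using (here)
open import Data.Product using (∃; _×_; _,_; proj₁; proj₂)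
import Data.Product.Function.Dependent.Propositional as Σ
open import Data.Product.Function.NonDependent.Propositional using (_×-cong_)
open import Data.Sum using (_⊎_; inj₁; inj₂; [_,_])
open import Data.Sum.Function.Propositional using (_⊎-cong_)
open import Data.Unit using (⊤; tt)
open import Data.Empty using (⊥; ⊥-elim)
open import Function using (_∘_; flip)
open import Function.Bundles using (mk⇔)
import Function.Properties.Equivalence as ⇔
open import Function.Properties.Inverse using (↔⇒⇔)
open import Level using (0ℓ)
open import Relation.Nullary using (¬_; Dec; yes; no)
open import Relation.Nullary.Decidable using (map′; ¬?; _⊎-dec_)
open import Relation.Unary using (Pred; _⊆_; _∪_; Empty; ｛_｝; Decidable)
open import Relation.Binary.PropositionalEquality using (_≡_; refl)

private variable
  X Y : Set
  P Q : Pred X 0ℓ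
  g : ℕ
  i : Fin g
  p : ℕ
  x y z w ψ χ φ : Form g
  R : Form g → Form g → Set

Image : (Y → X → Set) → Pred Y 0ℓ → Pred X 0ℓ
Image R P x = ∃ λ y → P y × R y x

IsFinite-resp : P ⊆ Q → Q ⊆ P → IsFinite P → IsFinite Q
IsFinite-resp P⊆Q Q⊆P (xs , P⇔∈) = xs , λ x → ⇔.trans (mk⇔ Q⊆P P⊆Q) (P⇔∈ x)

IsFinite-empty : Empty P → IsFinite P
IsFinite-empty ∄P = [] , λ x → mk⇔ (⊥-elim ∘ ∄P x) λ ()

IsFinite-singleton : (a : X) → IsFinite ｛ a ｝
IsFinite-singleton a = a ∷ [] , λ x → mk⇔ (λ { refl → here refl }) λ { (here refl) → refl }

IsFinite-∪ : IsFinite P → IsFinite Q → IsFinite (P ∪ Q)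
IsFinite-∪ (xs , P⇔∈) (ys , Q⇔∈) =
  xs ++ ys , λ x → ⇔.trans (P⇔∈ x ⊎-cong Q⇔∈ x) (⇔.sym ++-∈⇔)

IsFinite-Image : {R : Y → X → Set} → IsFinite P → (∀ y → IsFinite (R y)) → IsFinite (Image R P)
IsFinite-Image (ys , P⇔∈) R-finite = concatMap (proj₁ ∘ R-finite) ys , λ x →
  ⇔.trans (Σ.congˡ λ {y} → P⇔∈ y ×-cong proj₂ (R-finite y) x) (↔⇒⇔ >>=-∈↔)

IsFinite-guard : {A : Set} → Dec A → IsFinite P → IsFinite (λ x → A × P x)
IsFinite-guard (yes a) P-finite = IsFinite-resp (a ,_) proj₂ P-finite
IsFinite-guard (no ¬a) _        = IsFinite-empty λ _ → ¬a ∘ proj₁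

sub-trans : Sub x y → Sub y z → Sub x z
sub-trans s sub-refl      = s
sub-trans s (sub-neg t)   = sub-neg (sub-trans s t)
sub-trans s (sub-conjˡ t) = sub-conjˡ (sub-trans s t)
sub-trans s (sub-conjʳ t) = sub-conjʳ (sub-trans s t)
sub-trans s (sub-A t)     = sub-A (sub-trans s t)
sub-trans s (sub-I t)     = sub-I (sub-trans s t)
sub-trans s (sub-E t)     = sub-E (sub-trans s t)
sub-trans s (sub-Sim t)   = sub-Sim (sub-trans s t)
sub-trans s (sub-Circ t)  = sub-Circ (sub-trans s t)

SubClosed : Pred (Form g) 0ℓ → Set
SubClosed P = ∀ {x y} → P y → Sub x y → P x

Sub-finite-unary : (c : Form g → Form g) →
                   (∀ {x} → Sub x ψ → Sub x (c ψ)) →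
                   (∀ {x} → Sub x (c ψ) → c ψ ≡ x ⊎ Sub x ψ) →
                   IsFinite (λ x → Sub x ψ) → IsFinite (λ x → Sub x (c ψ))
Sub-finite-unary _ sub-c inv ψ-finite =
  IsFinite-resp [ (λ { refl → sub-refl }) , sub-c ] inv (IsFinite-∪ (IsFinite-singleton _) ψ-finite)

Sub-finite : (ψ : Form g) → IsFinite (λ x → Sub x ψ)
Sub-finite (atom p) =
  IsFinite-resp (λ { refl → sub-refl }) (λ { sub-refl → refl }) (IsFinite-singleton (atom p))
Sub-finite (neg ψ) =
  Sub-finite-unary neg sub-neg (λ { sub-refl → inj₁ refl ; (sub-neg s) → inj₂ s }) (Sub-finite ψ)
Sub-finite (conj ψ χ) =
  IsFinite-resp [ (λ { refl → sub-refl }) , [ sub-conjˡ , sub-conjʳ ] ]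
    (λ { sub-refl       → inj₁ refl
       ; (sub-conjˡ s) → inj₂ (inj₁ s)
       ; (sub-conjʳ s) → inj₂ (inj₂ s) })
    (IsFinite-∪ (IsFinite-singleton _) (IsFinite-∪ (Sub-finite ψ) (Sub-finite χ)))
Sub-finite (A i ψ) =
  Sub-finite-unary (A i) sub-A (λ { sub-refl → inj₁ refl ; (sub-A s) → inj₂ s }) (Sub-finite ψ)
Sub-finite (I i ψ) =
  Sub-finite-unary (I i) sub-I (λ { sub-refl → inj₁ refl ; (sub-I s) → inj₂ s }) (Sub-finite ψ)
Sub-finite (E i ψ) =
  Sub-finite-unary (E i) sub-E (λ { sub-refl → inj₁ refl ; (sub-E s) → inj₂ s }) (Sub-finite ψ)
Sub-finite (Sim i ψ) =
  Sub-finite-unary (Sim i) sub-Sim (λ { sub-refl → inj₁ refl ; (sub-Sim s) → inj₂ s }) (Sub-finite ψ)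
Sub-finite (Circ i ψ) =
  Sub-finite-unary (Circ i) sub-Circ (λ { sub-refl → inj₁ refl ; (sub-Circ s) → inj₂ s })
    (Sub-finite ψ)

Headed : (X → Form g) → Pred (Form g) 0ℓ
Headed f ψ = ∃ λ a → ψ ≡ f a

neg? : Decidable (Headed {g = g} neg)
neg? (neg χ)    = yes (χ , refl)
neg? (atom _)   = no λ { (_ , ()) }
neg? (conj _ _) = no λ { (_ , ()) }
neg? (A _ _)    = no λ { (_ , ()) }
neg? (I _ _)    = no λ { (_ , ()) }
neg? (E _ _)    = no λ { (_ , ()) }
neg? (Sim _ _)  = no λ { (_ , ()) }
neg? (Circ _ _) = no λ { (_ , ()) }

atom? : Decidable (Headed {g = g} atom)
atom? (atom p)   = yes (p , refl)
atom? (neg _)    = no λ { (_ , ()) }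
atom? (conj _ _) = no λ { (_ , ()) }
atom? (A _ _)    = no λ { (_ , ()) }
atom? (I _ _)    = no λ { (_ , ()) }
atom? (E _ _)    = no λ { (_ , ()) }
atom? (Sim _ _)  = no λ { (_ , ()) }
atom? (Circ _ _) = no λ { (_ , ()) }

I? : (i : Fin g) → Decidable (Headed (I i))
I? i (I j χ)    = map′ (λ { refl → χ , refl }) (λ { (_ , refl) → refl }) (j ≟ i)
I? i (atom _)   = no λ { (_ , ()) }
I? i (neg _)    = no λ { (_ , ()) }
I? i (conj _ _) = no λ { (_ , ()) }
I? i (A _ _)    = no λ { (_ , ()) }
I? i (E _ _)    = no λ { (_ , ()) }
I? i (Sim _ _)  = no λ { (_ , ()) }
I? i (Circ _ _) = no λ { (_ , ()) }

Sim? : (i : Fin g) → Decidable (Headed (Sim i))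
Sim? i (Sim j χ)  = map′ (λ { refl → χ , refl }) (λ { (_ , refl) → refl }) (j ≟ i)
Sim? i (atom _)   = no λ { (_ , ()) }
Sim? i (neg _)    = no λ { (_ , ()) }
Sim? i (conj _ _) = no λ { (_ , ()) }
Sim? i (A _ _)    = no λ { (_ , ()) }
Sim? i (I _ _)    = no λ { (_ , ()) }
Sim? i (E _ _)    = no λ { (_ , ()) }
Sim? i (Circ _ _) = no λ { (_ , ()) }

negated? : {f : X → Form g} → Decidable (Headed f) → Decidable (Headed (neg ∘ f))
negated? f? ψ with neg? ψ
... | yes (χ , refl) = map′ (λ { (a , refl) → a , refl }) (λ { (a , refl) → a , refl }) (f? χ)
... | no ¬neg        = no λ { (a , refl) → ¬neg (_ , refl) }

isIForm? : (i : Fin g) → Decidable (IsIForm i)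
isIForm? i ψ = I? i ψ ⊎-dec negated? (I? i) ψ

isSimForm? : (i : Fin g) → Decidable (IsSimForm i)
isSimForm? i ψ = Sim? i ψ ⊎-dec negated? (Sim? i) ψ

extend : Pred (Form g) 0ℓ → (Form g → Form g → Set) → Pred (Form g) 0ℓ
extend P R = P ∪ Image (flip Sub) (Image R P)

AddsOnly : (Form g → Form g → Set) → Pred (Form g) 0ℓ → Set
AddsOnly R Q = ∀ {z y x} → R z y → Sub x y → Sub x z ⊎ Q x

module _ {P : Pred (Form g) 0ℓ} where

  extend-step : P z → R z y → extend P R y
  extend-step p r = inj₂ (_ , (_ , p , r) , sub-refl)

  extend-subClosed : SubClosed P → SubClosed (extend P R)
  extend-subClosed P-closed (inj₁ p)           s = inj₁ (P-closed p s)
  extend-subClosed _        (inj₂ (y , r , t)) s = inj₂ (y , r , sub-trans s t)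

  extend-finite : IsFinite P → (∀ z → IsFinite (R z)) → IsFinite (extend P R)
  extend-finite P-finite R-finite =
    IsFinite-∪ P-finite (IsFinite-Image (IsFinite-Image P-finite R-finite) Sub-finite)

  extend-⊆ : {C : Pred (Form g) 0ℓ} →
             SubClosed C → P ⊆ C → (∀ {z y} → C z → R z y → C y) → extend P R ⊆ C
  extend-⊆ _        P⊆C _       (inj₁ p)                     = P⊆C p
  extend-⊆ C-closed P⊆C R-sound (inj₂ (_ , (_ , p , r) , s)) = C-closed (R-sound (P⊆C p) r) s

  extend-reflect : SubClosed P → AddsOnly R Q → extend P R x → ¬ Q x → P x
  extend-reflect _        _    (inj₁ p)                     _  = p
  extend-reflect P-closed adds (inj₂ (_ , (_ , p , r) , s)) ¬q =
    [ P-closed p , ⊥-elim ∘ ¬q ] (adds r s)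

data Rule₀ : Form g → Form g → Set where
  rule4    : Sub χ ψ → Rule₀ (A i ψ) (A i χ)
  rule4∘9a : Sub χ ψ → Rule₀ (E i ψ) (A i χ)
  rule9b   : Rule₀ (E i ψ) (Circ i ψ)

data Rule₁ : Form g → Form g → Set where
  rule5a : Rule₁ (A i ψ) (I i (A i ψ))
  rule5b : Rule₁ (A i ψ) (I i (neg (A i ψ)))
  rule5c : Sub (atom p) ψ → Rule₁ (A i ψ) (Sim i (atom p))
  rule8  : Rule₁ (Circ i ψ) (Sim i (I i (Circ i ψ)))

data Rule₂ : Form g → Form g → Set where
  rule6a : ¬ IsIForm i ψ → Rule₂ (I i ψ) (I i (I i ψ))
  rule6b : ¬ IsIForm i ψ → Rule₂ (I i ψ) (I i (neg (I i ψ)))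
  rule7a : ¬ IsSimForm i ψ → Rule₂ (Sim i ψ) (Sim i (Sim i ψ))
  rule7b : ¬ IsSimForm i ψ → Rule₂ (Sim i ψ) (Sim i (neg (Sim i ψ)))

data Rule₃ : Form g → Form g → Set where
  rule3 : ¬ IsNeg ψ → Rule₃ ψ (neg ψ)

Rule₀-sound : Cl φ z → Rule₀ z y → Cl φ y
Rule₀-sound c (rule4 s)    = cl-4 c s
Rule₀-sound c (rule4∘9a s) = cl-4 (cl-9a c) s
Rule₀-sound c rule9b       = cl-9b c

Rule₁-sound : Cl φ z → Rule₁ z y → Cl φ y
Rule₁-sound c rule5a     = cl-5a c
Rule₁-sound c rule5b     = cl-5b c
Rule₁-sound c (rule5c s) = cl-5c c s
Rule₁-sound c rule8      = cl-8 c

Rule₂-sound : Cl φ z → Rule₂ z y → Cl φ y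
Rule₂-sound c (rule6a ¬it) = cl-6a c ¬it
Rule₂-sound c (rule6b ¬it) = cl-6b c ¬it
Rule₂-sound c (rule7a ¬it) = cl-7a c ¬it
Rule₂-sound c (rule7b ¬it) = cl-7b c ¬it

Rule₃-sound : Cl φ z → Rule₃ z y → Cl φ y
Rule₃-sound c (rule3 ¬neg) = cl-3 c ¬neg

Rule₀-finite : (z : Form g) → IsFinite (Rule₀ z)
Rule₀-finite (A i ψ) =
  IsFinite-resp (λ { (_ , s , refl) → rule4 s }) (λ { (rule4 s) → _ , s , refl })
    (IsFinite-Image (Sub-finite ψ) (IsFinite-singleton ∘ A i))
Rule₀-finite (E i ψ) =
  IsFinite-resp [ (λ { (_ , s , refl) → rule4∘9a s }) , (λ { refl → rule9b }) ]
    (λ { (rule4∘9a s) → inj₁ (_ , s , refl) ; rule9b → inj₂ refl })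
    (IsFinite-∪ (IsFinite-Image (Sub-finite ψ) (IsFinite-singleton ∘ A i))
                (IsFinite-singleton (Circ i ψ)))
Rule₀-finite (atom _)   = IsFinite-empty λ _ ()
Rule₀-finite (neg _)    = IsFinite-empty λ _ ()
Rule₀-finite (conj _ _) = IsFinite-empty λ _ ()
Rule₀-finite (I _ _)    = IsFinite-empty λ _ ()
Rule₀-finite (Sim _ _)  = IsFinite-empty λ _ ()
Rule₀-finite (Circ _ _) = IsFinite-empty λ _ ()

Rule₁-finite : (z : Form g) → IsFinite (Rule₁ z)
Rule₁-finite (A i ψ) =
  IsFinite-resp
    [ (λ { refl → rule5a })
    , [ (λ { refl → rule5b }) , (λ { (_ , s , (_ , refl) , refl) → rule5c s }) ] ]
    (λ { rule5a     → inj₁ refl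
       ; rule5b     → inj₂ (inj₁ refl)
       ; (rule5c s) → inj₂ (inj₂ (_ , s , (_ , refl) , refl)) })
    (IsFinite-∪ (IsFinite-singleton _) (IsFinite-∪ (IsFinite-singleton _)
      (IsFinite-Image (Sub-finite ψ) λ a → IsFinite-guard (atom? a) (IsFinite-singleton (Sim i a)))))
Rule₁-finite (Circ i ψ) =
  IsFinite-resp (λ { refl → rule8 }) (λ { rule8 → refl }) (IsFinite-singleton _)
Rule₁-finite (atom _)   = IsFinite-empty λ _ ()
Rule₁-finite (neg _)    = IsFinite-empty λ _ ()
Rule₁-finite (conj _ _) = IsFinite-empty λ _ ()
Rule₁-finite (I _ _)    = IsFinite-empty λ _ ()
Rule₁-finite (E _ _)    = IsFinite-empty λ _ ()
Rule₁-finite (Sim _ _)  = IsFinite-empty λ _ ()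

Rule₂-finite : (z : Form g) → IsFinite (Rule₂ z)
Rule₂-finite (I i ψ) =
  IsFinite-resp (λ { (¬it , inj₁ refl) → rule6a ¬it ; (¬it , inj₂ refl) → rule6b ¬it })
    (λ { (rule6a ¬it) → ¬it , inj₁ refl ; (rule6b ¬it) → ¬it , inj₂ refl })
    (IsFinite-guard (¬? (isIForm? i ψ)) (IsFinite-∪ (IsFinite-singleton _) (IsFinite-singleton _)))
Rule₂-finite (Sim i ψ) =
  IsFinite-resp (λ { (¬it , inj₁ refl) → rule7a ¬it ; (¬it , inj₂ refl) → rule7b ¬it })
    (λ { (rule7a ¬it) → ¬it , inj₁ refl ; (rule7b ¬it) → ¬it , inj₂ refl })
    (IsFinite-guard (¬? (isSimForm? i ψ)) (IsFinite-∪ (IsFinite-singleton _) (IsFinite-singleton _)))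
Rule₂-finite (atom _)   = IsFinite-empty λ _ ()
Rule₂-finite (neg _)    = IsFinite-empty λ _ ()
Rule₂-finite (conj _ _) = IsFinite-empty λ _ ()
Rule₂-finite (A _ _)    = IsFinite-empty λ _ ()
Rule₂-finite (E _ _)    = IsFinite-empty λ _ ()
Rule₂-finite (Circ _ _) = IsFinite-empty λ _ ()

Rule₃-finite : (z : Form g) → IsFinite (Rule₃ z)
Rule₃-finite z =
  IsFinite-resp (λ { (¬neg , refl) → rule3 ¬neg }) (λ { (rule3 ¬neg) → ¬neg , refl })
    (IsFinite-guard (¬? (neg? z)) (IsFinite-singleton (neg z)))

Rule₀-sub : Rule₀ z y → Sub x y → x ≡ y ⊎ Sub x z
Rule₀-sub _            sub-refl     = inj₁ refl
Rule₀-sub (rule4 s)    (sub-A t)    = inj₂ (sub-A (sub-trans t s))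
Rule₀-sub (rule4∘9a s) (sub-A t)    = inj₂ (sub-E (sub-trans t s))
Rule₀-sub rule9b       (sub-Circ t) = inj₂ (sub-E t)

Rule₀-trans : Rule₀ w z → Rule₀ z y → Rule₀ w y
Rule₀-trans (rule4 s)    (rule4 t) = rule4 (sub-trans t s)
Rule₀-trans (rule4∘9a s) (rule4 t) = rule4∘9a (sub-trans t s)

NegIOrSim : Pred (Form g) 0ℓ
NegIOrSim (neg _)   = ⊤
NegIOrSim (I _ _)   = ⊤
NegIOrSim (Sim _ _) = ⊤
NegIOrSim _         = ⊥

data NegOrIterated : Pred (Form g) 0ℓ where
  negation     : NegOrIterated (neg ψ)
  I-iterated   : IsIForm i ψ → NegOrIterated (I i ψ)
  Sim-iterated : IsSimForm i ψ → NegOrIterated (Sim i ψ)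

NegOrIterated⇒NegIOrSim : NegOrIterated x → NegIOrSim x
NegOrIterated⇒NegIOrSim negation         = tt
NegOrIterated⇒NegIOrSim (I-iterated _)   = tt
NegOrIterated⇒NegIOrSim (Sim-iterated _) = tt

Rule₁-addsOnly : AddsOnly {g} Rule₁ NegIOrSim
Rule₁-addsOnly rule5a     sub-refl            = inj₂ tt
Rule₁-addsOnly rule5a     (sub-I s)           = inj₁ s
Rule₁-addsOnly rule5b     sub-refl            = inj₂ tt
Rule₁-addsOnly rule5b     (sub-I sub-refl)    = inj₂ tt
Rule₁-addsOnly rule5b     (sub-I (sub-neg s)) = inj₁ s
Rule₁-addsOnly (rule5c _) sub-refl            = inj₂ tt
Rule₁-addsOnly (rule5c s) (sub-Sim sub-refl)  = inj₁ (sub-A s)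
Rule₁-addsOnly rule8      sub-refl            = inj₂ tt
Rule₁-addsOnly rule8      (sub-Sim sub-refl)  = inj₂ tt
Rule₁-addsOnly rule8      (sub-Sim (sub-I s)) = inj₁ s

Rule₂-addsOnly : AddsOnly {g} Rule₂ NegOrIterated
Rule₂-addsOnly (rule6a _) sub-refl              = inj₂ (I-iterated (inj₁ (_ , refl)))
Rule₂-addsOnly (rule6a _) (sub-I s)             = inj₁ s
Rule₂-addsOnly (rule6b _) sub-refl              = inj₂ (I-iterated (inj₂ (_ , refl)))
Rule₂-addsOnly (rule6b _) (sub-I sub-refl)      = inj₂ negation
Rule₂-addsOnly (rule6b _) (sub-I (sub-neg s))   = inj₁ s
Rule₂-addsOnly (rule7a _) sub-refl              = inj₂ (Sim-iterated (inj₁ (_ , refl)))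
Rule₂-addsOnly (rule7a _) (sub-Sim s)           = inj₁ s
Rule₂-addsOnly (rule7b _) sub-refl              = inj₂ (Sim-iterated (inj₂ (_ , refl)))
Rule₂-addsOnly (rule7b _) (sub-Sim sub-refl)    = inj₂ negation
Rule₂-addsOnly (rule7b _) (sub-Sim (sub-neg s)) = inj₁ s

Rule₃-addsOnly : AddsOnly {g} Rule₃ IsNeg
Rule₃-addsOnly (rule3 _) sub-refl    = inj₂ (_ , refl)
Rule₃-addsOnly (rule3 _) (sub-neg s) = inj₁ s

Rule₀-premise : Rule₀ z y → ¬ NegIOrSim z
Rule₀-premise (rule4 _)    ()
Rule₀-premise (rule4∘9a _) ()
Rule₀-premise rule9b       ()

Rule₁-premise : Rule₁ z y → ¬ NegIOrSim z
Rule₁-premise rule5a     ()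
Rule₁-premise rule5b     ()
Rule₁-premise (rule5c _) ()
Rule₁-premise rule8      ()

Rule₂-premise : Rule₂ z y → ¬ NegOrIterated z
Rule₂-premise (rule6a ¬it) (I-iterated it)   = ¬it it
Rule₂-premise (rule6b ¬it) (I-iterated it)   = ¬it it
Rule₂-premise (rule7a ¬it) (Sim-iterated it) = ¬it it
Rule₂-premise (rule7b ¬it) (Sim-iterated it) = ¬it it

Rule₃-premise : Rule₃ z y → ¬ IsNeg z
Rule₃-premise (rule3 ¬neg) = ¬neg

module Stratification (φ : Form g) where

  Cl₀ Cl₁ Cl₂ Cl₃ : Pred (Form g) 0ℓ
  Cl₀ = (λ x → Sub x φ) ∪ Image Rule₀ (λ x → Sub x φ)
  Cl₁ = extend Cl₀ Rule₁
  Cl₂ = extend Cl₁ Rule₂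
  Cl₃ = extend Cl₂ Rule₃

  Cl₀-subClosed : SubClosed Cl₀
  Cl₀-subClosed (inj₁ s) t = inj₁ (sub-trans t s)
  Cl₀-subClosed (inj₂ (z , s , r)) t with Rule₀-sub r t
  ... | inj₁ refl = inj₂ (z , s , r)
  ... | inj₂ t′   = inj₁ (sub-trans t′ s)

  Cl₁-subClosed : SubClosed Cl₁
  Cl₁-subClosed = extend-subClosed Cl₀-subClosed

  Cl₂-subClosed : SubClosed Cl₂
  Cl₂-subClosed = extend-subClosed Cl₁-subClosed

  Cl₃-subClosed : SubClosed Cl₃
  Cl₃-subClosed = extend-subClosed Cl₂-subClosed

  Cl₀-finite : IsFinite Cl₀
  Cl₀-finite = IsFinite-∪ (Sub-finite φ) (IsFinite-Image (Sub-finite φ) Rule₀-finite)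

  Cl₃-finite : IsFinite Cl₃
  Cl₃-finite =
    extend-finite (extend-finite (extend-finite Cl₀-finite Rule₁-finite) Rule₂-finite) Rule₃-finite

  Cl₀⊆Cl : Cl₀ ⊆ Cl φ
  Cl₀⊆Cl (inj₁ s)           = cl-2 cl-1 s
  Cl₀⊆Cl (inj₂ (_ , s , r)) = Rule₀-sound (cl-2 cl-1 s) r

  Cl₃⊆Cl : Cl₃ ⊆ Cl φ
  Cl₃⊆Cl =
    extend-⊆ cl-2 (extend-⊆ cl-2 (extend-⊆ cl-2 Cl₀⊆Cl Rule₁-sound) Rule₂-sound) Rule₃-sound

  Cl₃⇒Cl₂ : Cl₃ x → ¬ IsNeg x → Cl₂ x
  Cl₃⇒Cl₂ = extend-reflect Cl₂-subClosed Rule₃-addsOnly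

  Cl₃⇒Cl₁ : Cl₃ x → ¬ NegOrIterated x → Cl₁ x
  Cl₃⇒Cl₁ c ¬it =
    extend-reflect Cl₁-subClosed Rule₂-addsOnly (Cl₃⇒Cl₂ c λ { (_ , refl) → ¬it negation }) ¬it

  Cl₃⇒Cl₀ : Cl₃ x → ¬ NegIOrSim x → Cl₀ x
  Cl₃⇒Cl₀ c ¬q =
    extend-reflect Cl₀-subClosed Rule₁-addsOnly (Cl₃⇒Cl₁ c (¬q ∘ NegOrIterated⇒NegIOrSim)) ¬q

  Cl₀-closed : Cl₀ z → Rule₀ z y → Cl₀ y
  Cl₀-closed (inj₁ s)            r = inj₂ (_ , s , r)
  Cl₀-closed (inj₂ (w , s , r′)) r = inj₂ (w , s , Rule₀-trans r′ r)

  Cl₃-closed₀ : Cl₃ z → Rule₀ z y → Cl₃ y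
  Cl₃-closed₀ c r = inj₁ (inj₁ (inj₁ (Cl₀-closed (Cl₃⇒Cl₀ c (Rule₀-premise r)) r)))

  Cl₃-closed₁ : Cl₃ z → Rule₁ z y → Cl₃ y
  Cl₃-closed₁ c r = inj₁ (inj₁ (extend-step (Cl₃⇒Cl₀ c (Rule₁-premise r)) r))

  Cl₃-closed₂ : Cl₃ z → Rule₂ z y → Cl₃ y
  Cl₃-closed₂ c r = inj₁ (extend-step (Cl₃⇒Cl₁ c (Rule₂-premise r)) r)

  Cl₃-closed₃ : Cl₃ z → Rule₃ z y → Cl₃ y
  Cl₃-closed₃ c r = extend-step (Cl₃⇒Cl₂ c (Rule₃-premise r)) r

  Cl⊆Cl₃ : Cl φ ⊆ Cl₃
  Cl⊆Cl₃ cl-1          = inj₁ (inj₁ (inj₁ (inj₁ sub-refl)))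
  Cl⊆Cl₃ (cl-2 c s)    = Cl₃-subClosed (Cl⊆Cl₃ c) s
  Cl⊆Cl₃ (cl-3 c ¬neg) = Cl₃-closed₃ (Cl⊆Cl₃ c) (rule3 ¬neg)
  Cl⊆Cl₃ (cl-4 c s)    = Cl₃-closed₀ (Cl⊆Cl₃ c) (rule4 s)
  Cl⊆Cl₃ (cl-5a c)     = Cl₃-closed₁ (Cl⊆Cl₃ c) rule5a
  Cl⊆Cl₃ (cl-5b c)     = Cl₃-closed₁ (Cl⊆Cl₃ c) rule5b
  Cl⊆Cl₃ (cl-5c c s)   = Cl₃-closed₁ (Cl⊆Cl₃ c) (rule5c s)
  Cl⊆Cl₃ (cl-6a c ¬it) = Cl₃-closed₂ (Cl⊆Cl₃ c) (rule6a ¬it)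
  Cl⊆Cl₃ (cl-6b c ¬it) = Cl₃-closed₂ (Cl⊆Cl₃ c) (rule6b ¬it)
  Cl⊆Cl₃ (cl-7a c ¬it) = Cl₃-closed₂ (Cl⊆Cl₃ c) (rule7a ¬it)
  Cl⊆Cl₃ (cl-7b c ¬it) = Cl₃-closed₂ (Cl⊆Cl₃ c) (rule7b ¬it)
  Cl⊆Cl₃ (cl-8 c)      = Cl₃-closed₁ (Cl⊆Cl₃ c) rule8
  Cl⊆Cl₃ (cl-9a c)     = Cl₃-closed₀ (Cl⊆Cl₃ c) (rule4∘9a sub-refl)
  Cl⊆Cl₃ (cl-9b c)     = Cl₃-closed₀ (Cl⊆Cl₃ c) rule9b

lemma5 : (g : ℕ) (φ : Form g) → IsFinite (Cl φ)
lemma5 g φ = IsFinite-resp Cl₃⊆Cl Cl⊆Cl₃ Cl₃-finite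
  where open Stratification φ
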